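{- Let $G$ be a connected graph. Then $b_{\rm g}(G)=3$ if and only if $\Delta(G) \le |V(G)|-3$ and there exists $v \in V(G)$ such that every vertex in $V(G) \setminus N[v]$ is adjacent to all but at most one vertex of $V(G)\setminus N_2[v]$.
   Context: $N[v]$ is the closed neighborhood of $v$ and $N_2[v]$ is the set of vertices at distance at most 2 from $v$ (including $v$). $\Delta(G)$ is the maximum degree. The burning game on a finite simple graph $G$ is played by two players, Burner and Staller. Each vertex is either burned or unburned, and once burned it stays burned. In round 1 the starting player chooses one unburned vertex and burns it (selection phase only). Each round $t \ge 2$ consists of a spreading phase, in which every unburned vertex with a burned neighbor becomes burned, followed, if unburned vertices remain, by a selection phase in which the player whose turn it is burns one unburned vertex; the two players make the selections alternately. The game ends in the first round in which all vertices are burned (this may happen right after a spreading phase), and its length is the number of that round. Burner wants to minimize the length and Staller to maximize it. $b_{\rm g}(G)$ is the length under optimal play when Burner makes the first selection. -}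

module Defs where

open import Data.Nat using (ℕ; zero; suc; _⊔_; _⊓_; _≤_; _+_)
open import Data.Bool using (Bool; true; false; not; _∧_; _∨_; if_then_else_)
open import Data.Fin using (Fin)
open import Data.Fin.Subset using (Subset; ∣_∣; ⁅_⁆; _∪_)
open import Data.Vec using (lookup; tabulate)
open import Data.List using (List; []; _∷_; map; foldr; filterᵇ; allFin)
open import Data.Bool.ListAction using (any; all)
open import Data.Product using (∃; _×_)
open import Data.Sum using (_⊎_)
open import Relation.Binary.PropositionalEquality using (_≡_)

record Graph (n : ℕ) : Set where
  field
    adj   : Fin n → Fin n → Bool
    sym   : ∀ u v → adj u v ≡ adj v u
    irrefl : ∀ v → adj v v ≡ false
open Graph public

module _ {n : ℕ} (G : Graph n) where

  Adj : Fin n → Fin n → Set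
  Adj u v = adj G u v ≡ true

  data Reach : Fin n → Fin n → Set where
    here : ∀ {u} → Reach u u
    step : ∀ {u v w} → Adj u v → Reach v w → Reach u w

  Connected : Set
  Connected = ∀ u v → Reach u v

  neighbourhood : Fin n → Subset n
  neighbourhood v = tabulate (λ u → adj G v u)

  deg : Fin n → ℕ
  deg v = ∣ neighbourhood v ∣

  InN : Fin n → Fin n → Set
  InN v u = u ≡ v ⊎ Adj v u

  InN2 : Fin n → Fin n → Set
  InN2 v u = u ≡ v ⊎ Adj v u ⊎ ∃ (λ w → Adj v w × Adj w u)

  allV : List (Fin n)
  allV = allFin n

  spread : Subset n → Subset n
  spread B = tabulate (λ u → lookup B u ∨ any (λ w → adj G u w ∧ lookup B w) allV)

  full : Subset n → Bool
  full B = all (lookup B) allV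

  unburned : Subset n → List (Fin n)
  unburned B = filterᵇ (λ v → not (lookup B v)) allV

data Player : Set where
  burner staller : Player

other : Player → Player
other burner = staller
other staller = burner

minL : List ℕ → ℕ
minL [] = 0
minL (x ∷ xs) = foldr _⊓_ x xs

maxL : List ℕ → ℕ
maxL = foldr _⊔_ 0

opt : Player → List ℕ → ℕ
opt burner = minL
opt staller = maxL

module _ {n : ℕ} (G : Graph n) where
  mutual
    -- p makes the selection of round t in the position with burned set B
    -- (B is the burned set after the spreading phase of round t, or ∅ if t = 1).
    -- fuel bounds the number of remaining selections (each selection burns a
    -- new vertex, so fuel n is never exhausted).
    select : ℕ → Player → ℕ → Subset n → ℕ
    select zero    p t B = t
    select (suc f) p t B =
      opt p (map (λ v → afterSelect f (other p) t (B ∪ ⁅ v ⁆)) (unburned G B))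

    afterSelect : ℕ → Player → ℕ → Subset n → ℕ
    afterSelect f p t B =
      if full G B then t
      else (if full G (spread G B) then suc t
            else select f p (suc t) (spread G B))

  bg : ℕ
  bg = select n burner 1 Data.Fin.Subset.⊥

module Submission where

-- After Burner's first selection v and the spread of round 2 the burned set
-- is N[v]. If at most one vertex lies outside N[v], the game ends in round 2;
-- if two do, one of them survives Staller's selection, so the game lasts at
-- least three rounds. After Staller's reply x and the spread of round 3 the
-- burned set is N₂[v] ∪ N[x]: Burner ends the game in round 3 iff at most one
-- vertex lies outside it, and otherwise one of two such vertices survives his
-- selection. As bg is the minimum over the first selections, bg = 3 iff every
-- v leaves two vertices outside N[v] (a degree count: Δ ≤ n − 3) and some v
-- meets the condition on N₂[v] ∪ N[x] for all replies x.

open import Data.Bool using (true; false; not; T; T?; _∧_)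
open import Data.Bool.ListAction using (any)
open import Data.Bool.Properties using (T-≡; T-∨; T-∧)
open import Data.Fin using (Fin; zero; suc; _≟_)
open import Data.Fin.Properties using (all?; ¬∀⟶∃¬)
open import Data.Fin.Subset using (Subset; _∈_; _∉_; _⊆_; ⁅_⁆; _∪_; ∣_∣; outside; inside)
  renaming (⊥ to ∅)
open import Data.Fin.Subset.Properties
  using (_∈?_; ∉⊥; ∣⊥∣≡0; ∣p∣≤n; x∈⁅x⁆; x∈⁅y⁆⇒x≡y; x∈p∪q⁺; x∈p∪q⁻; p⊆p∪q; ∪-identityʳ;
         drop-there; drop-not-there)
open import Data.List using ([]; _∷_; map)
import Data.List.Membership.Propositional as List
open import Data.List.Membership.Propositional using (lose)
open import Data.List.Membership.Propositional.Properties
  using (foldr-selective; ∈-allFin; ∈-map⁺; ∈-map⁻; ∈-filter⁺; ∈-filter⁻)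
open import Data.List.Properties using (foldr-preservesᵒ; foldr-preservesᵇ)
import Data.List.Relation.Unary.All as All
open import Data.List.Relation.Unary.All.Properties using (all⁺; all⁻)
open import Data.List.Relation.Unary.Any as Any using (Any; here; there; satisfied)
open import Data.List.Relation.Unary.Any.Properties using (any⁺; any⁻)
open import Data.Nat using (ℕ; zero; suc; _<_; _≤_; _+_; z≤n; s≤s)
open import Data.Nat.Properties
  using (≤-refl; ≤-trans; ≤-reflexive; ≤-antisym; <⇒≤; ≤-pred; 1+n≰n; n≤1+n; +-comm;
         ⊓-sel; ⊓-glb; ⊔-lub; m≤n⇒m⊓o≤n; m≤n⇒o⊓m≤n; m≤n⇒m≤n⊔o; m≤n⇒m≤o⊔n; module ≤-Reasoning)
open import Data.Product using (∃; ∃₂; _×_; _,_; proj₁; proj₂)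
open import Data.Sum as Sum using (_⊎_; inj₁; inj₂; [_,_]′)
open import Data.Vec using ([]; _∷_; here; lookup)
open import Data.Vec.Properties using ([]=⇒lookup; lookup⇒[]=; lookup∘tabulate)
open import Function using (_∘_; id)
open import Function.Bundles using (_⇔_; mk⇔; Equivalence)
open import Function.Construct.Composition using (_⇔-∘_)
open import Function.Construct.Symmetry using (⇔-sym)
open import Relation.Binary.PropositionalEquality using (_≡_; _≢_; refl; sym; trans; cong; subst)
open import Relation.Nullary using (¬_; contradiction; yes; no)

open import Defs hiding (sym)

private variable
  n : ℕ
  p : Subset n
  x y z : Fin n

∉-∪⁅⁆ : y ∉ p → y ≢ x → y ∉ p ∪ ⁅ x ⁆
∉-∪⁅⁆ {p = p} {x = x} y∉p y≢x y∈ =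
  [ y∉p , (λ y∈⁅x⁆ → y≢x (x∈⁅y⁆⇒x≡y x y∈⁅x⁆)) ]′ (x∈p∪q⁻ p ⁅ x ⁆ y∈)

∉-∪⁅⁆⁻ : y ∉ p ∪ ⁅ x ⁆ → y ∉ p × y ≢ x
∉-∪⁅⁆⁻ {x = x} y∉ =
  (λ y∈p → y∉ (x∈p∪q⁺ (inj₁ y∈p))) , (λ { refl → y∉ (x∈p∪q⁺ (inj₂ (x∈⁅x⁆ x))) })

∣p∪⁅x⁆∣≡1+∣p∣ : x ∉ p → ∣ p ∪ ⁅ x ⁆ ∣ ≡ suc ∣ p ∣
∣p∪⁅x⁆∣≡1+∣p∣ {x = zero}  {p = inside  ∷ p} x∉p = contradiction here x∉p
∣p∪⁅x⁆∣≡1+∣p∣ {x = zero}  {p = outside ∷ p} _   = cong (λ q → suc ∣ q ∣) (∪-identityʳ p)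
∣p∪⁅x⁆∣≡1+∣p∣ {x = suc x} {p = inside  ∷ p} x∉p = cong suc (∣p∪⁅x⁆∣≡1+∣p∣ (drop-not-there x∉p))
∣p∪⁅x⁆∣≡1+∣p∣ {x = suc x} {p = outside ∷ p} x∉p = ∣p∪⁅x⁆∣≡1+∣p∣ (drop-not-there x∉p)

∣p∣<n⇒∃∉ : ∀ {n} {p : Subset n} → ∣ p ∣ < n → ∃ (_∉ p)
∣p∣<n⇒∃∉ {p = []} ()
∣p∣<n⇒∃∉ {p = outside ∷ p} _ = zero , λ ()
∣p∣<n⇒∃∉ {p = inside  ∷ p} (s≤s ∣p∣<n) with ∣p∣<n⇒∃∉ ∣p∣<n
... | x , x∉p = suc x , λ x∈ → x∉p (drop-there x∈)

outside³⇒∣p∣+3≤n : ∀ {n} {p : Subset n} {x y z} → x ∉ p → y ∉ p → z ∉ p →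
                   x ≢ y → x ≢ z → y ≢ z → ∣ p ∣ + 3 ≤ n
outside³⇒∣p∣+3≤n {n} {p} {x} {y} {z} x∉p y∉p z∉p x≢y x≢z y≢z = begin
  ∣ p ∣ + 3                      ≡⟨ +-comm ∣ p ∣ 3 ⟩
  suc (suc (suc ∣ p ∣))          ≡⟨ cong (λ k → suc (suc k)) (∣p∪⁅x⁆∣≡1+∣p∣ x∉p) ⟨
  suc (suc ∣ p ∪ ⁅ x ⁆ ∣)         ≡⟨ cong suc (∣p∪⁅x⁆∣≡1+∣p∣ y∉p∪x) ⟨
  suc ∣ (p ∪ ⁅ x ⁆) ∪ ⁅ y ⁆ ∣      ≡⟨ ∣p∪⁅x⁆∣≡1+∣p∣ z∉p∪x∪y ⟨
  ∣ ((p ∪ ⁅ x ⁆) ∪ ⁅ y ⁆) ∪ ⁅ z ⁆ ∣ ≤⟨ ∣p∣≤n (((p ∪ ⁅ x ⁆) ∪ ⁅ y ⁆) ∪ ⁅ z ⁆) ⟩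
  n                              ∎
  where
  open ≤-Reasoning
  y∉p∪x : y ∉ p ∪ ⁅ x ⁆
  y∉p∪x = ∉-∪⁅⁆ y∉p (x≢y ∘ sym)
  z∉p∪x∪y : z ∉ (p ∪ ⁅ x ⁆) ∪ ⁅ y ⁆
  z∉p∪x∪y = ∉-∪⁅⁆ (∉-∪⁅⁆ z∉p (x≢z ∘ sym)) (y≢z ∘ sym)

2+∣p∣≤n⇒∃∉p∪⁅x⁆ : ∀ {n} {p : Subset n} {x} → x ∉ p → suc (suc ∣ p ∣) ≤ n → ∃ (_∉ p ∪ ⁅ x ⁆)
2+∣p∣≤n⇒∃∉p∪⁅x⁆ {n} x∉p 2+∣p∣≤n =
  ∣p∣<n⇒∃∉ (subst (λ k → suc k ≤ n) (sym (∣p∪⁅x⁆∣≡1+∣p∣ x∉p)) 2+∣p∣≤n)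

∣p∣+3≤n⇒outside² : ∀ {n} {p : Subset n} {x} → x ∉ p → ∣ p ∣ + 3 ≤ n →
                   ∃₂ λ y z → y ≢ z × (y ∉ p × y ≢ x) × (z ∉ p × z ≢ x)
∣p∣+3≤n⇒outside² {n} {p} {x} x∉p ∣p∣+3≤n = outside² (subst (_≤ n) (+-comm ∣ p ∣ 3) ∣p∣+3≤n)
  where
  outside² : 3 + ∣ p ∣ ≤ n → ∃₂ λ y z → y ≢ z × (y ∉ p × y ≢ x) × (z ∉ p × z ≢ x)
  outside² 3+∣p∣≤n
    with y , y∉p∪x ← 2+∣p∣≤n⇒∃∉p∪⁅x⁆ x∉p (<⇒≤ 3+∣p∣≤n)
    with z , z∉p∪x∪y ← 2+∣p∣≤n⇒∃∉p∪⁅x⁆ y∉p∪x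
                          (subst (λ k → suc (suc k) ≤ n) (sym (∣p∪⁅x⁆∣≡1+∣p∣ x∉p)) 3+∣p∣≤n)
    = let z∉p∪x , z≢y = ∉-∪⁅⁆⁻ z∉p∪x∪y in
      y , z , z≢y ∘ sym , ∉-∪⁅⁆⁻ y∉p∪x , ∉-∪⁅⁆⁻ z∉p∪x

AtMostOneOutside : Subset n → Set
AtMostOneOutside p = ∀ x y → x ∉ p → y ∉ p → x ≡ y

∪⁅⁆-full : AtMostOneOutside p → y ∉ p → ∀ x → x ∈ p ∪ ⁅ y ⁆
∪⁅⁆-full {p = p} {y = y} one y∉p x with x ∈? p
... | yes x∈p = x∈p∪q⁺ (inj₁ x∈p)
... | no  x∉p = subst (_∈ p ∪ ⁅ y ⁆) (sym (one x y x∉p y∉p)) (x∈p∪q⁺ (inj₂ (x∈⁅x⁆ y)))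

full⊎∃∉ : ∀ (p : Subset n) → (∀ x → x ∈ p) ⊎ ∃ (_∉ p)
full⊎∃∉ p with all? (_∈? p)
... | yes all∈ = inj₁ all∈
... | no ¬all∈ = inj₂ (¬∀⟶∃¬ _ (_∈ p) (_∈? p) ¬all∈)

TwoOutside : Subset n → Set
TwoOutside p = ∃₂ λ x y → x ≢ y × x ∉ p × y ∉ p

AtMostOneOutside⊎TwoOutside : ∀ (p : Subset n) → AtMostOneOutside p ⊎ TwoOutside p
AtMostOneOutside⊎TwoOutside p with full⊎∃∉ p
... | inj₁ all∈ = inj₁ λ x _ x∉p _ → contradiction (all∈ x) x∉p
... | inj₂ (x , x∉p) with full⊎∃∉ (p ∪ ⁅ x ⁆)
...   | inj₂ (y , y∉) = let y∉p , y≢x = ∉-∪⁅⁆⁻ y∉ in inj₂ (x , y , y≢x ∘ sym , x∉p , y∉p)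
...   | inj₁ all∈ = inj₁ λ a b a∉p b∉p → trans (only-x a∉p) (sym (only-x b∉p))
  where
  only-x : ∀ {a} → a ∉ p → a ≡ x
  only-x {a} a∉p = [ (λ a∈p → contradiction a∈p a∉p) , x∈⁅y⁆⇒x≡y x ]′ (x∈p∪q⁻ p ⁅ x ⁆ (all∈ a))

distinct³⇒3≤n : ∀ {n} {x y z : Fin n} → x ≢ y → x ≢ z → y ≢ z → 3 ≤ n
distinct³⇒3≤n {n} x≢y x≢z y≢z =
  subst (λ k → k + 3 ≤ n) (∣⊥∣≡0 n) (outside³⇒∣p∣+3≤n ∉⊥ ∉⊥ ∉⊥ x≢y x≢z y≢z)

∈⇒T-lookup : x ∈ p → T (lookup p x)
∈⇒T-lookup = Equivalence.from T-≡ ∘ []=⇒lookup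

T-lookup⇒∈ : T (lookup p x) → x ∈ p
T-lookup⇒∈ = lookup⇒[]= _ _ ∘ Equivalence.to T-≡

∉⇒T-not-lookup : x ∉ p → T (not (lookup p x))
∉⇒T-not-lookup {x = x} {p = p} x∉p with lookup p x in eq
... | true  = contradiction (lookup⇒[]= _ _ eq) x∉p
... | false = _

T-not-lookup⇒∉ : T (not (lookup p x)) → x ∉ p
T-not-lookup⇒∉ t x∈p rewrite []=⇒lookup x∈p = t

minL-≤ : ∀ {x xs} → x List.∈ xs → minL xs ≤ x
minL-≤ {x} {y ∷ ys} x∈ =
  foldr-preservesᵒ {P = _≤ x} (λ a b → [ m≤n⇒m⊓o≤n b , m≤n⇒o⊓m≤n a ]′) y ys (head-or-tail x∈)
  where
  head-or-tail : x List.∈ y ∷ ys → y ≤ x ⊎ Any (_≤ x) ys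
  head-or-tail (here refl)  = inj₁ ≤-refl
  head-or-tail (there x∈ys) = inj₂ (Any.map (λ { refl → ≤-refl }) x∈ys)

minL-∈ : ∀ {x xs} → x List.∈ xs → minL xs List.∈ xs
minL-∈ {xs = y ∷ ys} _ = [ here , there ]′ (foldr-selective ⊓-sel y ys)

≤-maxL : ∀ {x xs} → x List.∈ xs → x ≤ maxL xs
≤-maxL {x} {xs} x∈ =
  foldr-preservesᵒ {P = x ≤_} (λ a b → [ m≤n⇒m≤n⊔o b , m≤n⇒m≤o⊔n a ]′) 0 xs
    (inj₂ (Any.map (λ { refl → ≤-refl }) x∈))

opt-≤ : ∀ p {xs k} → (∀ {y} → y List.∈ xs → y ≤ k) → opt p xs ≤ k
opt-≤ burner  {[]}     _ = z≤n
opt-≤ burner  {y ∷ ys} h = ≤-trans (minL-≤ {xs = y ∷ ys} (here refl)) (h (here refl))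
opt-≤ staller {k = k}  h = foldr-preservesᵇ {P = _≤ k} ⊔-lub z≤n (All.tabulate h)

-- The member x is needed because minL [] is 0.
≤-opt : ∀ p {xs k x} → x List.∈ xs → (∀ {y} → y List.∈ xs → k ≤ y) → k ≤ opt p xs
≤-opt burner  {y ∷ ys} {k} _ h =
  foldr-preservesᵇ {P = k ≤_} ⊓-glb {xs = ys} (h (here refl)) (All.tabulate (h ∘ there))
≤-opt staller x∈ h = ≤-trans (h x∈) (≤-maxL x∈)

module BurningGame {n} (G : Graph n) where

  adj-sym : ∀ {u w} → Adj G u w → Adj G w u
  adj-sym {u} {w} = trans (Graph.sym G w u)

  ∈-spread⁻ : ∀ {B u} → u ∈ spread G B → u ∈ B ⊎ ∃ λ w → Adj G u w × w ∈ B
  ∈-spread⁻ {B} {u} u∈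
    with Equivalence.to T-∨ (subst T (lookup∘tabulate _ u) (∈⇒T-lookup u∈))
  ... | inj₁ u∈B = inj₁ (T-lookup⇒∈ u∈B)
  ... | inj₂ t with w , adj∧w∈ ← satisfied (any⁻ _ (allV G) t) =
    let adj , w∈B = Equivalence.to T-∧ adj∧w∈ in
    inj₂ (w , Equivalence.to T-≡ adj , T-lookup⇒∈ w∈B)

  ∈-spread⁺ : ∀ {B u} → u ∈ B ⊎ (∃ λ w → Adj G u w × w ∈ B) → u ∈ spread G B
  ∈-spread⁺ {B} {u} h =
    T-lookup⇒∈ (subst T (sym (lookup∘tabulate _ u))
      (Equivalence.from T-∨ (Sum.map ∈⇒T-lookup neighbour h)))
    where
    neighbour : (∃ λ w → Adj G u w × w ∈ B) → T (any (λ w → adj G u w ∧ lookup B w) (allV G))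
    neighbour (w , adj , w∈B) =
      any⁺ _ (lose (∈-allFin w) (Equivalence.from T-∧ (Equivalence.from T-≡ adj , ∈⇒T-lookup w∈B)))

  spread-mono : ∀ {B C} → B ⊆ C → spread G B ⊆ spread G C
  spread-mono B⊆C = ∈-spread⁺ ∘ Sum.map B⊆C (λ (w , adj , w∈B) → w , adj , B⊆C w∈B) ∘ ∈-spread⁻

  ∉-spread-∅ : ∀ {u} → u ∉ spread G ∅
  ∉-spread-∅ u∈ = [ ∉⊥ , (λ (_ , _ , w∈∅) → ∉⊥ w∈∅) ]′ (∈-spread⁻ u∈)

  ∈-spread-∪⁅⁆ : ∀ {B x u} → u ∈ spread G (B ∪ ⁅ x ⁆) ⇔ (u ∈ spread G B ⊎ InN G x u)
  ∈-spread-∪⁅⁆ {B} {x} {u} = mk⇔ to from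
    where
    to : u ∈ spread G (B ∪ ⁅ x ⁆) → u ∈ spread G B ⊎ InN G x u
    to u∈ with ∈-spread⁻ u∈
    ... | inj₁ u∈B∪x = Sum.map (∈-spread⁺ {B} ∘ inj₁) (inj₁ ∘ x∈⁅y⁆⇒x≡y x) (x∈p∪q⁻ B ⁅ x ⁆ u∈B∪x)
    ... | inj₂ (w , adj , w∈B∪x) with x∈p∪q⁻ B ⁅ x ⁆ w∈B∪x
    ...   | inj₁ w∈B  = inj₁ (∈-spread⁺ {B} (inj₂ (w , adj , w∈B)))
    ...   | inj₂ w∈⁅x⁆ with refl ← x∈⁅y⁆⇒x≡y x w∈⁅x⁆ = inj₂ (inj₂ (adj-sym adj))
    x∈B∪x : x ∈ B ∪ ⁅ x ⁆
    x∈B∪x = x∈p∪q⁺ (inj₂ (x∈⁅x⁆ x))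
    from : u ∈ spread G B ⊎ InN G x u → u ∈ spread G (B ∪ ⁅ x ⁆)
    from (inj₁ u∈)          = spread-mono {B} {B ∪ ⁅ x ⁆} (p⊆p∪q ⁅ x ⁆) u∈
    from (inj₂ (inj₁ refl)) = ∈-spread⁺ {B ∪ ⁅ x ⁆} (inj₁ x∈B∪x)
    from (inj₂ (inj₂ adj))  = ∈-spread⁺ {B ∪ ⁅ x ⁆} (inj₂ (x , adj-sym adj , x∈B∪x))

  full⁺ : ∀ {B} → (∀ u → u ∈ B) → full G B ≡ true
  full⁺ {B} all∈ =
    Equivalence.to T-≡ (all⁻ (lookup B) {allV G} (All.tabulate (λ {u} _ → ∈⇒T-lookup (all∈ u))))

  full⁻ : ∀ {B} → full G B ≡ true → ∀ u → u ∈ B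
  full⁻ {B} full≡true u =
    T-lookup⇒∈ (All.lookup (all⁺ (lookup B) (allV G) (Equivalence.from T-≡ full≡true)) (∈-allFin u))

  full-∉ : ∀ {B u} → u ∉ B → full G B ≡ false
  full-∉ {B} {u} u∉B with full G B in eq
  ... | true  = contradiction (full⁻ eq u) u∉B
  ... | false = refl

  ∈-unburned⁺ : ∀ {B u} → u ∉ B → u List.∈ unburned G B
  ∈-unburned⁺ {B} u∉B = ∈-filter⁺ (T? ∘ not ∘ lookup B) (∈-allFin _) (∉⇒T-not-lookup u∉B)

  ∈-unburned⁻ : ∀ {B u} → u List.∈ unburned G B → u ∉ B
  ∈-unburned⁻ {B} u∈ = T-not-lookup⇒∉ (proj₂ (∈-filter⁻ (T? ∘ not ∘ lookup B) {xs = allV G} u∈))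

  afterSelect-full : ∀ {f p t B} → (∀ u → u ∈ B) → afterSelect G f p t B ≡ t
  afterSelect-full all∈ rewrite full⁺ all∈ = refl

  afterSelect-spread-full : ∀ {f p t B u} → u ∉ B → (∀ w → w ∈ spread G B) →
                            afterSelect G f p t B ≡ suc t
  afterSelect-spread-full u∉B all∈ rewrite full-∉ u∉B | full⁺ all∈ = refl

  afterSelect≡select : ∀ {f p t B u} → u ∉ spread G B →
                       afterSelect G f p t B ≡ select G f p (suc t) (spread G B)
  afterSelect≡select {B = B} u∉ rewrite full-∉ {B} (u∉ ∘ ∈-spread⁺ ∘ inj₁) | full-∉ u∉ = refl

  afterSelect-≤ : ∀ {f p t B k} → suc t ≤ k → select G f p (suc t) (spread G B) ≤ k →
                  afterSelect G f p t B ≤ k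
  afterSelect-≤ {f} {p} {t} {B} t<k sel≤k with full⊎∃∉ B
  ... | inj₁ all∈ = ≤-trans (≤-reflexive (afterSelect-full {f} {p} {t} all∈)) (<⇒≤ t<k)
  ... | inj₂ (u , u∉B) with full⊎∃∉ (spread G B)
  ...   | inj₁ all∈     = ≤-trans (≤-reflexive (afterSelect-spread-full {f} {p} {t} u∉B all∈)) t<k
  ...   | inj₂ (w , w∉) = ≤-trans (≤-reflexive (afterSelect≡select {f} {p} {t} {B} w∉)) sel≤k

  move-∈ : ∀ {B y} (g : Fin n → ℕ) → y ∉ B → g y List.∈ map g (unburned G B)
  move-∈ g = ∈-map⁺ g ∘ ∈-unburned⁺

  ∀-moves : ∀ {B} {P : ℕ → Set} (g : Fin n → ℕ) → (∀ y → y ∉ B → P (g y)) →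
            ∀ {z} → z List.∈ map g (unburned G B) → P z
  ∀-moves g h z∈ with y , y∈ , refl ← ∈-map⁻ g z∈ = h y (∈-unburned⁻ y∈)

  select-≤ : ∀ {f p t B k} → (∀ y → y ∉ B → afterSelect G f (other p) t (B ∪ ⁅ y ⁆) ≤ k) →
             select G (suc f) p t B ≤ k
  select-≤ {f} {p} {t} {B} h = opt-≤ p (∀-moves (λ y → afterSelect G f (other p) t (B ∪ ⁅ y ⁆)) h)

  ≤-select : ∀ {f p t B k u} → u ∉ B →
             (∀ y → y ∉ B → k ≤ afterSelect G f (other p) t (B ∪ ⁅ y ⁆)) →
             k ≤ select G (suc f) p t B
  ≤-select {f} {p} {t} {B} u∉B h =
    ≤-opt p (move-∈ (λ y → afterSelect G f (other p) t (B ∪ ⁅ y ⁆)) u∉B) (∀-moves _ h)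

  select-burner-≤ : ∀ {f t B k y} → y ∉ B → afterSelect G f staller t (B ∪ ⁅ y ⁆) ≤ k →
                    select G (suc f) burner t B ≤ k
  select-burner-≤ {f} {t} {B} y∉B ≤k =
    ≤-trans (minL-≤ (move-∈ (λ y → afterSelect G f staller t (B ∪ ⁅ y ⁆)) y∉B)) ≤k

  select-staller-≥ : ∀ {f t B k y} → y ∉ B → k ≤ afterSelect G f burner t (B ∪ ⁅ y ⁆) →
                     k ≤ select G (suc f) staller t B
  select-staller-≥ {f} {t} {B} y∉B k≤ =
    ≤-trans k≤ (≤-maxL (move-∈ (λ y → afterSelect G f burner t (B ∪ ⁅ y ⁆)) y∉B))

  select-burner-attained : ∀ {f t B u} → u ∉ B →
    ∃ λ y → select G (suc f) burner t B ≡ afterSelect G f staller t (B ∪ ⁅ y ⁆)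
  select-burner-attained {f} {t} {B} u∉B
    with y , _ , eq ← ∈-map⁻ _ (minL-∈ (move-∈ (λ y → afterSelect G f staller t (B ∪ ⁅ y ⁆)) u∉B))
    = y , eq

  AtMostOneOutside⇒select≤t : ∀ {f p t B} → AtMostOneOutside B → select G f p t B ≤ t
  AtMostOneOutside⇒select≤t {zero}          _   = ≤-refl
  AtMostOneOutside⇒select≤t {suc f} {p} {t} one =
    select-≤ {f} {p} λ y y∉B → ≤-reflexive (afterSelect-full {f} {other p} {t} (∪⁅⁆-full one y∉B))

  mutual
    t≤select : ∀ {f p t B u} → u ∉ B → t ≤ select G f p t B
    t≤select {zero}          _   = ≤-refl
    t≤select {suc f} {p} {t} {B} u∉B =
      ≤-select {f} {p} {t} u∉B (λ y _ → t≤afterSelect {f} {other p} {t} {B ∪ ⁅ y ⁆})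

    t≤afterSelect : ∀ {f p t B} → t ≤ afterSelect G f p t B
    t≤afterSelect {f} {p} {t} {B} with full⊎∃∉ B
    ... | inj₁ all∈      = ≤-reflexive (sym (afterSelect-full {f} {p} {t} all∈))
    ... | inj₂ (_ , u∉B) = <⇒≤ (t<afterSelect {f} {p} {t} u∉B)

    t<afterSelect : ∀ {f p t B u} → u ∉ B → t < afterSelect G f p t B
    t<afterSelect {f} {p} {t} {B} u∉B with full⊎∃∉ (spread G B)
    ... | inj₁ all∈     = ≤-reflexive (sym (afterSelect-spread-full {f} {p} {t} u∉B all∈))
    ... | inj₂ (_ , w∉) =
      ≤-trans (t≤select {f} {p} w∉) (≤-reflexive (sym (afterSelect≡select {f} {p} {t} {B} w∉)))

  TwoOutside⇒t<select : ∀ {f p t B} → TwoOutside B → t < select G (suc f) p t B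
  TwoOutside⇒t<select {f} {p} {t} {B} (u , w , u≢w , u∉B , w∉B) =
    ≤-select {f} {p} {t} u∉B (λ y _ → t<afterSelect {f} {other p} {t} (proj₂ (still-unburned y)))
    where
    still-unburned : ∀ y → ∃ (_∉ B ∪ ⁅ y ⁆)
    still-unburned y with u ≟ y
    ... | yes refl = w , ∉-∪⁅⁆ w∉B (u≢w ∘ sym)
    ... | no u≢y   = u , ∉-∪⁅⁆ u∉B u≢y

  N[_] : Fin n → Subset n
  N[ v ] = spread G (∅ ∪ ⁅ v ⁆)

  ∈-N[] : ∀ {v u} → u ∈ N[ v ] ⇔ InN G v u
  ∈-N[] = mk⇔ ([ (λ u∈ → contradiction u∈ ∉-spread-∅) , id ]′ ∘ Equivalence.to (∈-spread-∪⁅⁆ {∅}))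
              (Equivalence.from (∈-spread-∪⁅⁆ {∅}) ∘ inj₂)

  ∈-spread-N[] : ∀ {v u} → u ∈ spread G N[ v ] ⇔ InN2 G v u
  ∈-spread-N[] {v} {u} = mk⇔ to from
    where
    to : u ∈ spread G N[ v ] → InN2 G v u
    to u∈ with ∈-spread⁻ u∈
    ... | inj₁ u∈N = [ inj₁ , inj₂ ∘ inj₁ ]′ (Equivalence.to ∈-N[] u∈N)
    ... | inj₂ (w , adj , w∈N) with Equivalence.to ∈-N[] w∈N
    ...   | inj₁ refl  = inj₂ (inj₁ (adj-sym adj))
    ...   | inj₂ adj′  = inj₂ (inj₂ (w , adj′ , adj-sym adj))
    from : InN2 G v u → u ∈ spread G N[ v ]
    from (inj₁ u≡v)               = ∈-spread⁺ (inj₁ (Equivalence.from ∈-N[] (inj₁ u≡v)))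
    from (inj₂ (inj₁ adj))        = ∈-spread⁺ (inj₁ (Equivalence.from ∈-N[] (inj₂ adj)))
    from (inj₂ (inj₂ (w , vw , wu))) =
      ∈-spread⁺ (inj₂ (w , adj-sym wu , Equivalence.from ∈-N[] (inj₂ vw)))

  ∈-neighbourhood : ∀ {v u} → u ∈ neighbourhood G v ⇔ Adj G v u
  ∈-neighbourhood {v} {u} =
    mk⇔ (λ u∈ → trans (sym (lookup∘tabulate _ u)) ([]=⇒lookup u∈))
        (λ adj → lookup⇒[]= u _ (trans (lookup∘tabulate _ u) adj))

  ∉N[]⇔ : ∀ {v u} → u ∉ N[ v ] ⇔ (u ∉ neighbourhood G v × u ≢ v)
  ∉N[]⇔ {v} = mk⇔
    (λ u∉ → u∉ ∘ Equivalence.from (∈-N[] {v}) ∘ inj₂ ∘ Equivalence.to ∈-neighbourhood ,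
            u∉ ∘ Equivalence.from (∈-N[] {v}) ∘ inj₁)
    (λ (u∉nbhd , u≢v) →
      [ u≢v , u∉nbhd ∘ Equivalence.from ∈-neighbourhood ]′ ∘ Equivalence.to (∈-N[] {v}))

  deg+3≤n⇔TwoOutside : ∀ {v} → deg G v + 3 ≤ n ⇔ TwoOutside N[ v ]
  deg+3≤n⇔TwoOutside {v} = mk⇔ to from
    where
    v∉nbhd : v ∉ neighbourhood G v
    v∉nbhd v∈ = contradiction (trans (sym (irrefl G v)) (Equivalence.to ∈-neighbourhood v∈)) λ ()
    to : deg G v + 3 ≤ n → TwoOutside N[ v ]
    to le with a , b , a≢b , a∉ , b∉ ← ∣p∣+3≤n⇒outside² v∉nbhd le =
      a , b , a≢b , Equivalence.from ∉N[]⇔ a∉ , Equivalence.from ∉N[]⇔ b∉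
    from : TwoOutside N[ v ] → deg G v + 3 ≤ n
    from (a , b , a≢b , a∉ , b∉) =
      let a∉nbhd , a≢v = Equivalence.to ∉N[]⇔ a∉
          b∉nbhd , b≢v = Equivalence.to ∉N[]⇔ b∉
      in outside³⇒∣p∣+3≤n v∉nbhd a∉nbhd b∉nbhd (a≢v ∘ sym) (b≢v ∘ sym) a≢b

  N₂[_]∪N[_] : Fin n → Fin n → Subset n
  N₂[ v ]∪N[ x ] = spread G (N[ v ] ∪ ⁅ x ⁆)

  ∉N₂[]∪N[]⇔ : ∀ {v x u} → u ∉ N₂[ v ]∪N[ x ] ⇔ (¬ InN2 G v u × ¬ InN G x u)
  ∉N₂[]∪N[]⇔ {v} {x} = mk⇔
    (λ u∉ → u∉ ∘ Equivalence.from (∈-spread-∪⁅⁆ {N[ v ]}) ∘ inj₁ ∘ Equivalence.from ∈-spread-N[] ,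
            u∉ ∘ Equivalence.from (∈-spread-∪⁅⁆ {N[ v ]}) ∘ inj₂)
    (λ (¬N₂ , ¬N) →
      [ ¬N₂ ∘ Equivalence.to ∈-spread-N[] , ¬N ]′ ∘ Equivalence.to (∈-spread-∪⁅⁆ {N[ v ]}))

  Centre₃ : Fin n → Set
  Centre₃ v = ∀ u → ¬ InN G v u →
              ∀ w₁ w₂ → ¬ InN2 G v w₁ → ¬ InN2 G v w₂ →
              ¬ InN G u w₁ → ¬ InN G u w₂ → w₁ ≡ w₂

  Centre₃⇔AtMostOneOutside : ∀ {v} →
    Centre₃ v ⇔ (∀ x → x ∉ N[ v ] → AtMostOneOutside N₂[ v ]∪N[ x ])
  Centre₃⇔AtMostOneOutside {v} = mk⇔
    (λ centre x x∉ w₁ w₂ w₁∉ w₂∉ →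
      let ¬N₂w₁ , ¬Nw₁ = Equivalence.to ∉N₂[]∪N[]⇔ w₁∉
          ¬N₂w₂ , ¬Nw₂ = Equivalence.to ∉N₂[]∪N[]⇔ w₂∉
      in centre x (x∉ ∘ Equivalence.from ∈-N[]) w₁ w₂ ¬N₂w₁ ¬N₂w₂ ¬Nw₁ ¬Nw₂)
    (λ one u ¬Nu w₁ w₂ ¬N₂w₁ ¬N₂w₂ ¬Nw₁ ¬Nw₂ →
      one u (¬Nu ∘ Equivalence.to ∈-N[]) w₁ w₂
        (Equivalence.from ∉N₂[]∪N[]⇔ (¬N₂w₁ , ¬Nw₁)) (Equivalence.from ∉N₂[]∪N[]⇔ (¬N₂w₂ , ¬Nw₂)))

module _ {m} (G : Graph (suc m)) where

  open BurningGame G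

  -- The fuel of select is m = n − 1 in round 2, so the lower bounds below use
  -- three distinct vertices to see that it does not run out before round 3.
  opening : Fin (suc m) → ℕ
  opening v = afterSelect G m staller 1 (∅ ∪ ⁅ v ⁆)

  bg≡k⇔ : ∀ {k} → bg G ≡ k ⇔ ((∀ v → k ≤ opening v) × ∃ λ v → opening v ≤ k)
  bg≡k⇔ = mk⇔ to from
    where
    bg≤opening : ∀ v → bg G ≤ opening v
    bg≤opening v = select-burner-≤ {m} {1} {∅} (∉⊥ {x = v}) ≤-refl
    to : ∀ {k} → bg G ≡ k → (∀ v → k ≤ opening v) × ∃ λ v → opening v ≤ k
    to refl with v , bg≡ ← select-burner-attained {m} {1} {∅} (∉⊥ {x = zero}) =
      bg≤opening , v , ≤-reflexive (sym bg≡)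
    from : ∀ {k} → (∀ v → k ≤ opening v) × (∃ λ v → opening v ≤ k) → bg G ≡ k
    from (lower , v , upper) =
      ≤-antisym (≤-trans (bg≤opening v) upper)
                (≤-select {m} {burner} {1} {∅} (∉⊥ {x = v}) (λ v _ → lower v))

  opening≡select : ∀ {v x} → x ∉ N[ v ] → opening v ≡ select G m staller 2 (N[ v ])
  opening≡select {v} = afterSelect≡select {m} {staller} {1} {∅ ∪ ⁅ v ⁆}

  opening≤2 : ∀ {v} → AtMostOneOutside N[ v ] → opening v ≤ 2
  opening≤2 {v} one =
    afterSelect-≤ {m} {staller} {1} {∅ ∪ ⁅ v ⁆} ≤-refl
      (AtMostOneOutside⇒select≤t {m} {staller} {2} one)

  3≤opening⇔TwoOutside : ∀ {v} → 3 ≤ opening v ⇔ TwoOutside N[ v ]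
  3≤opening⇔TwoOutside {v} = mk⇔ to from
    where
    to : 3 ≤ opening v → TwoOutside N[ v ]
    to 3≤ with AtMostOneOutside⊎TwoOutside N[ v ]
    ... | inj₁ one = contradiction (≤-trans 3≤ (opening≤2 {v} one)) 1+n≰n
    ... | inj₂ two = two
    from : TwoOutside N[ v ] → 3 ≤ opening v
    from two@(a , b , a≢b , a∉ , b∉) = begin
      3                              ≤⟨ round2 m (≤-pred (distinct³⇒3≤n v≢a v≢b a≢b)) ⟩
      select G m staller 2 N[ v ]    ≡⟨ opening≡select {v} a∉ ⟨
      opening v                      ∎
      where
      open ≤-Reasoning
      v≢a : v ≢ a
      v≢a = proj₂ (Equivalence.to (∉N[]⇔ {v}) a∉) ∘ sym
      v≢b : v ≢ b
      v≢b = proj₂ (Equivalence.to (∉N[]⇔ {v}) b∉) ∘ sym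
      round2 : ∀ f → 2 ≤ f → 3 ≤ select G f staller 2 N[ v ]
      round2 (suc f) _ = TwoOutside⇒t<select {f} {staller} {2} two

  opening≤3⇔AtMostOneOutside : ∀ {v} →
    opening v ≤ 3 ⇔ (∀ x → x ∉ N[ v ] → AtMostOneOutside N₂[ v ]∪N[ x ])
  opening≤3⇔AtMostOneOutside {v} = mk⇔ to from
    where
    open ≤-Reasoning
    to : opening v ≤ 3 → ∀ x → x ∉ N[ v ] → AtMostOneOutside N₂[ v ]∪N[ x ]
    to ≤3 x x∉ with AtMostOneOutside⊎TwoOutside N₂[ v ]∪N[ x ]
    ... | inj₁ one = one
    ... | inj₂ two@(w₁ , _ , _ , w₁∉ , _) = contradiction (≤-trans 4≤opening ≤3) 1+n≰n
      where
      v≢w₁ : v ≢ w₁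
      v≢w₁ = proj₁ (Equivalence.to (∉N₂[]∪N[]⇔ {v} {x}) w₁∉) ∘ inj₁ ∘ sym
      x≢w₁ : x ≢ w₁
      x≢w₁ = proj₂ (Equivalence.to (∉N₂[]∪N[]⇔ {v} {x}) w₁∉) ∘ inj₁ ∘ sym
      round3 : ∀ f → 1 ≤ f → 4 ≤ afterSelect G f burner 2 (N[ v ] ∪ ⁅ x ⁆)
      round3 (suc f) _ = begin
        4                                         ≤⟨ TwoOutside⇒t<select {f} {burner} {3} two ⟩
        select G (suc f) burner 3 N₂[ v ]∪N[ x ]  ≡⟨ afterSelect≡select {suc f} {burner} {2} {B} w₁∉ ⟨
        afterSelect G (suc f) burner 2 B          ∎
        where
        B : Subset (suc m)
        B = N[ v ] ∪ ⁅ x ⁆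
      round2 : ∀ f → 2 ≤ f → 4 ≤ select G f staller 2 N[ v ]
      round2 (suc f) (s≤s 1≤f) = select-staller-≥ {f} {2} {N[ v ]} x∉ (round3 f 1≤f)
      4≤opening : 4 ≤ opening v
      4≤opening = begin
        4                            ≤⟨ round2 m (≤-pred (distinct³⇒3≤n v≢x v≢w₁ x≢w₁)) ⟩
        select G m staller 2 N[ v ]  ≡⟨ opening≡select {v} x∉ ⟨
        opening v                    ∎
        where
        v≢x : v ≢ x
        v≢x = proj₂ (Equivalence.to (∉N[]⇔ {v}) x∉) ∘ sym
    from : (∀ x → x ∉ N[ v ] → AtMostOneOutside N₂[ v ]∪N[ x ]) → opening v ≤ 3
    from one = afterSelect-≤ {m} {staller} {1} {∅ ∪ ⁅ v ⁆} (n≤1+n 2) (round2 m)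
      where
      round2 : ∀ f → select G f staller 2 N[ v ] ≤ 3
      round2 zero    = n≤1+n 2
      round2 (suc f) = select-≤ {f} {staller} {2} {N[ v ]} λ x x∉ →
        afterSelect-≤ {f} {burner} {2} {N[ v ] ∪ ⁅ x ⁆} ≤-refl
          (AtMostOneOutside⇒select≤t {f} {burner} {3} (one x x∉))

  3≤opening⇔deg+3≤n : ∀ {v} → 3 ≤ opening v ⇔ deg G v + 3 ≤ suc m
  3≤opening⇔deg+3≤n {v} = ⇔-sym (deg+3≤n⇔TwoOutside {v}) ⇔-∘ 3≤opening⇔TwoOutside {v}

  opening≤3⇔Centre₃ : ∀ {v} → opening v ≤ 3 ⇔ Centre₃ v
  opening≤3⇔Centre₃ {v} = ⇔-sym (Centre₃⇔AtMostOneOutside {v}) ⇔-∘ opening≤3⇔AtMostOneOutside {v}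

proposition2p10 : (n : ℕ) → 0 < n → (G : Graph n) → Connected G →
    (bg G ≡ 3) ⇔
      ((∀ v → deg G v + 3 ≤ n) ×
       ∃ (λ v → ∀ u → ¬ InN G v u →
          ∀ w₁ w₂ → ¬ InN2 G v w₁ → ¬ InN2 G v w₂ →
            ¬ InN G u w₁ → ¬ InN G u w₂ → w₁ ≡ w₂))
proposition2p10 (suc m) _ G _ = mk⇔
  (λ bg≡3 → let lower , v , upper = to (bg≡k⇔ G) bg≡3 in
    (λ u → to (3≤opening⇔deg+3≤n G) (lower u)) , v , to (opening≤3⇔Centre₃ G) upper)
  (λ (deg-bound , v , centre) → from (bg≡k⇔ G)
    ((λ u → from (3≤opening⇔deg+3≤n G) (deg-bound u)) , v , from (opening≤3⇔Centre₃ G) centre))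
  where open Equivalence
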